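{- Let $m\ge 4$ be even. Then no finite sequence of Kempe swaps starting from the canonical coloring of $D_3(m)$ produces a coloring $(f_0,f_1,f_2)$ in which each $f_c$ is a single cycle of length $m^3$ on $V$ (i.e. a decomposition of the arcs of $D_3(m)$ into three directed Hamilton cycles).
   Context: Let $V=(\mathbb Z_m)^3$ and $e_1,e_2,e_3$ the standard basis vectors; $D_3(m)$ is the digraph on $V$ with arcs $v\to v+e_1,v+e_2,v+e_3$ (mod $m$). A coloring of $D_3(m)$ is a triple $(f_0,f_1,f_2)$ of permutations of $V$ with $\{f_0(v),f_1(v),f_2(v)\}=\{v+e_1,v+e_2,v+e_3\}$ for all $v$. The canonical coloring is $f_0(v)=v+e_1$, $f_1(v)=v+e_2$, $f_2(v)=v+e_3$. For colors $r\ne s$ the Kempe map of a coloring is $\tau_{r,s}=f_s^{ -1}\circ f_r$. A Kempe swap of colors $(r,s)$ on a set $X\subseteq V$ which is a union of cycles of $\tau_{r,s}$ (for the current coloring) replaces $f_r,f_s$ by $f'_r=f_s$, $f'_s=f_r$ on $X$ and leaves everything else unchanged; the result is again a coloring. -}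

module Defs where

open import Data.Nat using (ℕ; zero; suc; NonZero)
open import Data.Nat.DivMod using (_mod_)
open import Data.Fin using (Fin; toℕ; _≟_)
open import Data.Fin.Patterns using (0F; 1F; 2F)
open import Data.Product using (Σ; ∃; _×_; _,_)
open import Data.Bool using (Bool; true; false; if_then_else_)
open import Relation.Nullary using (¬_; yes; no)
open import Relation.Binary.PropositionalEquality using (_≡_; _≢_)
open import Relation.Binary.Construct.Closure.ReflexiveTransitive using (Star)
open import Function.Bundles using (_⇔_)
open import Function.Definitions using (Bijective)

V : ℕ → Set
V m = Fin m × Fin m × Fin m

inc : ∀ {m} .{{_ : NonZero m}} → Fin m → Fin m
inc {m} x = suc (toℕ x) mod m

-- v + e_i  for i ∈ {0,1,2} (standing for e_1, e_2, e_3).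
_+e_ : ∀ {m} .{{_ : NonZero m}} → V m → Fin 3 → V m
(a , b , c) +e 0F = (inc a , b , c)
(a , b , c) +e 1F = (a , inc b , c)
(a , b , c) +e 2F = (a , b , inc c)

Maps : ℕ → Set
Maps m = Fin 3 → V m → V m

IsColoring : ∀ {m} .{{_ : NonZero m}} → Maps m → Set
IsColoring {m} f =
  (∀ c → Bijective _≡_ _≡_ (f c)) ×
  (∀ (v : V m) →
     (∀ c → ∃ λ i → f c v ≡ v +e i) ×
     (∀ i → ∃ λ c → f c v ≡ v +e i))

canonical : ∀ {m} .{{_ : NonZero m}} → Maps m
canonical c v = v +e c

-- X ⊆ V (given by a Boolean indicator) is a union of cycles of
-- τ_{r,s} = f_s⁻¹ ∘ f_r : for every v and w = τ_{r,s}(v) (i.e. f_s w = f_r v),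
-- v ∈ X iff w ∈ X.
IsUnionOfCycles : ∀ {m} → Maps m → Fin 3 → Fin 3 → (V m → Bool) → Set
IsUnionOfCycles {m} f r s X =
  ∀ (v w : V m) → f s w ≡ f r v → (X v ≡ true ⇔ X w ≡ true)

swap : ∀ {m} → Maps m → Fin 3 → Fin 3 → (V m → Bool) → Maps m
swap f r s X c v with X v | c ≟ r | c ≟ s
... | false | _     | _     = f c v
... | true  | yes _ | _     = f s v
... | true  | no _  | yes _ = f r v
... | true  | no _  | no _  = f c v

KempeStep : ∀ {m} .{{_ : NonZero m}} → Maps m → Maps m → Set
KempeStep {m} f g =
  IsColoring f ×
  (Σ (Fin 3) λ r → Σ (Fin 3) λ s → r ≢ s ×
     (Σ (V m → Bool) λ X → IsUnionOfCycles f r s X ×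
        (∀ c v → g c v ≡ swap f r s X c v)))

KempeReachable : ∀ {m} .{{_ : NonZero m}} → Maps m → Maps m → Set
KempeReachable = Star KempeStep

iter : ∀ {A : Set} → (A → A) → ℕ → A → A
iter g zero x = x
iter g (suc k) x = g (iter g k x)

IsSingleCycle : ∀ {m} → (V m → V m) → Set
IsSingleCycle {m} g = ∀ (v w : V m) → ∃ λ k → iter g k v ≡ w

{-# OPTIONS --safe #-}

-- The total sign sgn f₀ + sgn f₁ + sgn f₂ ∈ ℤ/2 is invariant under Kempe swaps: swapping r and s
-- on a union X of cycles of τ_{r,s} replaces f_r by f_r ∘ ρ and f_s by f_s ∘ ρ⁻¹, where ρ is τ_{s,r}
-- on X and the identity elsewhere. For even m each translation v ↦ v + e_i is the square of a
-- permutation, so the invariant is 0 at the canonical colouring. A Hamilton cycle through the m³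
-- vertices is a cycle of even length, hence odd, so a decomposition into three Hamilton cycles
-- has invariant 1. Signs are parities of inversion counts, taken after enumerating V by Fin m³.

module Submission where

open import Defs
open import Data.Nat using (ℕ; NonZero; _≤_)
open import Data.Nat.Divisibility using (_∣_)
open import Data.Product using (_×_)
open import Relation.Nullary using (¬_)

open import Data.Nat as ℕ using (zero; suc; pred; _<_; _∸_; s≤s⁻¹; parity)
open import Data.Nat.Properties
  using (n<1+n; <⇒≤; <⇒≱; ≤-antisym; ≤-trans; m∸n≤m; m<n⇒0<n∸m; m+[n∸m]≡n)
open import Data.Nat.Divisibility using (divides)
open import Data.Nat.DivMod using (_%_; _/_; _mod_; m≡m%n+[m/n]*n; m%n<n; n%n≡0; m<n⇒m%n≡m)
open import Data.Fin as Fin using (Fin; zero; suc; toℕ; fromℕ; inject₁; _≟_)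
open import Data.Fin.Properties
  using ( toℕ-injective; toℕ-fromℕ; toℕ-fromℕ<; toℕ-inject₁; toℕ<n; <-cmp; pigeonhole
        ; injective⇒≤; *↔×)
open import Data.Fin.Relation.Unary.Top using (view; ‵fromℕ; ‵inject₁)
open import Data.Fin.Patterns using (0F; 1F; 2F)
open import Data.Parity.Base using (Parity; 0ℙ; 1ℙ; _+_; _*_; _⁻¹)
open import Data.Parity.Properties
  using ( p+p≡0ℙ; +-identityʳ; +-comm; +-cancelˡ-≡; +-cancelʳ-≡; *-zeroʳ; ⁻¹-selfInverse
        ; suc-homo-⁻¹; *-homo-*; +-0-commutativeMonoid; +-*-commutativeRing)
open import Algebra.Properties.CommutativeMonoid.Sum +-0-commutativeMonoid
  using (sum-syntax; sum-cong-≗; ∑-distrib-+; ∑-permute; sum-replicate-zero)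
open import Tactic.RingSolver.Core.AlmostCommutativeRing using (AlmostCommutativeRing; fromCommutativeRing)
open import Tactic.RingSolver using (solve-∀)
open import Level using (0ℓ)
open import Data.Bool using (Bool; true; false; if_then_else_)
open import Data.Bool.Properties using (⇔→≡)
open import Data.Maybe using (just; nothing)
open import Data.Product using (∃; _,_; proj₁; proj₂)
open import Data.Product.Function.NonDependent.Propositional using (_×-↔_)
open import Function using (_∘_; id; _↔_; Inverse; mk↔ₛ′; Injection)
open import Function.Definitions using (Injective; Bijective)
open import Function.Bundles using (mk⤖)
open import Function.Properties.Inverse using (↔-refl; ↔-sym; ↔-trans; ↔⇒↣)
open import Function.Properties.Bijection using (⤖⇒↔)
open import Relation.Nullary using (yes; no; contradiction)
open import Relation.Binary.Definitions using (tri<; tri≈; tri>)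
open import Relation.Binary.PropositionalEquality
  using (_≡_; _≢_; _≗_; refl; sym; trans; cong; cong₂; subst; module ≡-Reasoning)
open import Relation.Binary.Construct.Closure.ReflexiveTransitive using (ε; _◅_)

open Inverse using (to; from; strictlyInverseˡ; strictlyInverseʳ)
open ≡-Reasoning

ℙ-ring : AlmostCommutativeRing 0ℓ 0ℓ
ℙ-ring = fromCommutativeRing +-*-commutativeRing λ { 0ℙ → just refl ; 1ℙ → nothing }

to-injective : ∀ {A B : Set} (π : A ↔ B) → Injective _≡_ _≡_ (to π)
to-injective π = Injection.injective (↔⇒↣ π)

parity-suc : ∀ n → parity (suc n) ≡ parity n ⁻¹
parity-suc n = sym (⁻¹-selfInverse (suc-homo-⁻¹ n))

parity-even : ∀ {m} → 2 ∣ m → parity m ≡ 0ℙ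
parity-even (divides q refl) = trans (*-homo-* q 2) (*-zeroʳ (parity q))

∑-1ℙ≡parity : ∀ n → ∑[ i < n ] 1ℙ ≡ parity n
∑-1ℙ≡parity zero    = refl
∑-1ℙ≡parity (suc n) = trans (cong (1ℙ +_) (∑-1ℙ≡parity n)) (sym (parity-suc n))

-- Signs of permutations of Fin n

∑∑ : ∀ {n} → (Fin n → Fin n → Parity) → Parity
∑∑ {n} H = ∑[ i < n ] ∑[ j < n ] H i j

∑∑-cong : ∀ {n} {G H : Fin n → Fin n → Parity} →
          (∀ i j → G i j ≡ H i j) → ∑∑ G ≡ ∑∑ H
∑∑-cong G≡H = sum-cong-≗ (λ i → sum-cong-≗ (G≡H i))

∑∑-distrib-+ : ∀ {n} (G H : Fin n → Fin n → Parity) →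
               ∑∑ (λ i j → G i j + H i j) ≡ ∑∑ G + ∑∑ H
∑∑-distrib-+ {n} G H = trans (sum-cong-≗ (λ i → ∑-distrib-+ (G i) (H i)))
                             (∑-distrib-+ (λ i → ∑[ j < n ] G i j) (λ i → ∑[ j < n ] H i j))

∑∑-permute : ∀ {n} (π : Fin n ↔ Fin n) (H : Fin n → Fin n → Parity) →
             ∑∑ (λ i j → H (to π i) (to π j)) ≡ ∑∑ H
∑∑-permute {n} π H = sym (trans (∑-permute (λ i → ∑[ j < n ] H i j) π)
                                 (sum-cong-≗ (λ i → ∑-permute (H (to π i)) π)))

∑∑-symmetric : ∀ {n} (H : Fin n → Fin n → Parity) →
               (∀ i j → H i j ≡ H j i) → (∀ i → H i i ≡ 0ℙ) → ∑∑ H ≡ 0ℙ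
∑∑-symmetric {zero} H _ _ = refl
∑∑-symmetric {suc n} H H-sym H-diag = begin
  (H zero zero + row) + ∑[ i < n ] (H (suc i) zero + ∑[ j < n ] H (suc i) (suc j))
    ≡⟨ cong₂ (λ d r → (d + row) + r) (H-diag zero)
             (∑-distrib-+ (λ i → H (suc i) zero) (λ i → ∑[ j < n ] H′ i j)) ⟩
  row + (∑[ i < n ] H (suc i) zero + ∑∑ H′)
    ≡⟨ cong₂ (λ c r → row + (c + r)) (sum-cong-≗ (λ i → H-sym (suc i) zero))
             (∑∑-symmetric H′ (λ i j → H-sym (suc i) (suc j)) (H-diag ∘ suc)) ⟩
  row + (row + 0ℙ)
    ≡⟨ cong (row +_) (+-identityʳ row) ⟩
  row + row
    ≡⟨ p+p≡0ℙ row ⟩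
  0ℙ ∎
  where
  row : Parity
  row = ∑[ j < n ] H zero (suc j)
  H′ : Fin n → Fin n → Parity
  H′ i j = H (suc i) (suc j)

[_<_] : ∀ {n} → Fin n → Fin n → Parity
[ zero  < zero  ] = 0ℙ
[ zero  < suc _ ] = 1ℙ
[ suc _ < zero  ] = 0ℙ
[ suc i < suc j ] = [ i < j ]

[<]-irrefl : ∀ {n} (i : Fin n) → [ i < i ] ≡ 0ℙ
[<]-irrefl zero = refl
[<]-irrefl (suc i) = [<]-irrefl i

[<]-flip : ∀ {n} {i j : Fin n} → i ≢ j → [ j < i ] ≡ 1ℙ + [ i < j ]
[<]-flip {i = zero}  {zero}  i≢j = contradiction refl i≢j
[<]-flip {i = zero}  {suc j} _   = refl
[<]-flip {i = suc i} {zero}  _   = refl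
[<]-flip {i = suc i} {suc j} i≢j = [<]-flip (i≢j ∘ cong suc)

[<]-inject₁ : ∀ {n} (i j : Fin n) → [ inject₁ i < inject₁ j ] ≡ [ i < j ]
[<]-inject₁ zero    zero    = refl
[<]-inject₁ zero    (suc j) = refl
[<]-inject₁ (suc i) zero    = refl
[<]-inject₁ (suc i) (suc j) = [<]-inject₁ i j

[fromℕ<inject₁]≡0ℙ : ∀ {n} (j : Fin n) → [ fromℕ n < inject₁ j ] ≡ 0ℙ
[fromℕ<inject₁]≡0ℙ zero    = refl
[fromℕ<inject₁]≡0ℙ (suc j) = [fromℕ<inject₁]≡0ℙ j

reversed : ∀ {n} → (Fin n → Fin n) → Fin n → Fin n → Parity
reversed σ i j = [ i < j ] + [ σ i < σ j ]

reversed-sym : ∀ {n} {σ : Fin n → Fin n} → Injective _≡_ _≡_ σ →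
               ∀ i j → reversed σ i j ≡ reversed σ j i
reversed-sym {σ = σ} σ-inj i j with i ≟ j
... | yes refl = refl
... | no i≢j = sym (trans (cong₂ _+_ ([<]-flip i≢j) ([<]-flip (i≢j ∘ σ-inj)))
                         (ones-cancel [ i < j ] [ σ i < σ j ]))
  where
  ones-cancel : ∀ a b → (1ℙ + a) + (1ℙ + b) ≡ a + b
  ones-cancel = solve-∀ ℙ-ring

sgn : ∀ {n} → (Fin n → Fin n) → Parity
sgn σ = ∑∑ λ i j → [ i < j ] * reversed σ i j

sgn-cong : ∀ {n} {σ τ : Fin n → Fin n} → σ ≗ τ → sgn σ ≡ sgn τ
sgn-cong σ≗τ =
  ∑∑-cong (λ i j → cong₂ (λ a b → [ i < j ] * ([ i < j ] + [ a < b ])) (σ≗τ i) (σ≗τ j))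

sgn-∘ : ∀ {n} {σ : Fin n → Fin n} → Injective _≡_ _≡_ σ → (π : Fin n ↔ Fin n) →
        sgn (σ ∘ to π) ≡ sgn σ + sgn (to π)
sgn-∘ {n} {σ} σ-inj π = begin
  sgn (σ ∘ τ)
    ≡⟨ ∑∑-cong (λ i j → split [ i < j ] [ τ i < τ j ] [ σ (τ i) < σ (τ j) ]) ⟩
  ∑∑ (λ i j → (P i j + Q i j) + ([ i < j ] * reversed τ i j))
    ≡⟨ ∑∑-distrib-+ (λ i j → P i j + Q i j) (λ i j → [ i < j ] * reversed τ i j) ⟩
  ∑∑ (λ i j → P i j + Q i j) + sgn τ
    ≡⟨ cong (_+ sgn τ) (∑∑-distrib-+ P Q) ⟩
  (∑∑ P + ∑∑ Q) + sgn τ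
    ≡⟨ cong₂ (λ p q → (p + q) + sgn τ) (∑∑-permute π (λ i j → [ i < j ] * reversed σ i j))
                                       (∑∑-symmetric Q Q-sym Q-diag) ⟩
  (sgn σ + 0ℙ) + sgn τ
    ≡⟨ cong (_+ sgn τ) (+-identityʳ (sgn σ)) ⟩
  sgn σ + sgn τ ∎
  where
  τ : Fin n → Fin n
  τ = to π
  P Q : Fin n → Fin n → Parity
  P i j = [ τ i < τ j ] * reversed σ (τ i) (τ j)
  Q i j = reversed τ i j * reversed σ (τ i) (τ j)
  -- Split [ i < j ] as [ τ i < τ j ] + reversed τ i j: the first part reindexes to sgn σ, the second
  -- gives the symmetric Q.
  split : ∀ a b c → a * (a + c) ≡ ((b * (b + c)) + ((a + b) * (b + c))) + (a * (a + b))
  split = solve-∀ ℙ-ring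
  Q-sym : ∀ i j → Q i j ≡ Q j i
  Q-sym i j = cong₂ _*_ (reversed-sym (to-injective π) i j) (reversed-sym σ-inj (τ i) (τ j))
  Q-diag : ∀ i → Q i i ≡ 0ℙ
  Q-diag i = cong₂ (λ a b → (a + b) * reversed σ (τ i) (τ i)) ([<]-irrefl i) ([<]-irrefl (τ i))

sgn-id : ∀ {n} → sgn {n} id ≡ 0ℙ
sgn-id {n} = trans (sgn-∘ {n} id ↔-refl) (p+p≡0ℙ (sgn {n} id))

sgn-inverse : ∀ {n} (π : Fin n ↔ Fin n) → sgn (from π) ≡ sgn (to π)
sgn-inverse {n} π = +-cancelˡ-≡ (sgn (to π)) _ _ (begin
  sgn (to π) + sgn (from π) ≡⟨ sgn-∘ (to-injective π) (↔-sym π) ⟨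
  sgn (to π ∘ from π)       ≡⟨ sgn-cong (strictlyInverseˡ π) ⟩
  sgn {n} id                ≡⟨ sgn-id {n} ⟩
  0ℙ                        ≡⟨ p+p≡0ℙ (sgn (to π)) ⟨
  sgn (to π) + sgn (to π)   ∎)

sgn-conjugate : ∀ {n} {σ : Fin n → Fin n} → Injective _≡_ _≡_ σ → (h ρ : Fin n ↔ Fin n) →
                σ ∘ to h ≗ to h ∘ to ρ → sgn σ ≡ sgn (to ρ)
sgn-conjugate {σ = σ} σ-inj h ρ σh≗hρ = +-cancelʳ-≡ (sgn (to h)) _ _ (begin
  sgn σ + sgn (to h)      ≡⟨ sgn-∘ σ-inj h ⟨
  sgn (σ ∘ to h)          ≡⟨ sgn-cong σh≗hρ ⟩
  sgn (to h ∘ to ρ)       ≡⟨ sgn-∘ (to-injective h) ρ ⟩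
  sgn (to h) + sgn (to ρ) ≡⟨ +-comm (sgn (to h)) (sgn (to ρ)) ⟩
  sgn (to ρ) + sgn (to h) ∎)

-- The sign of a cycle

dec : ∀ {n} → Fin (suc n) → Fin (suc n)
dec {n} zero = fromℕ n
dec (suc i) = inject₁ i

inc-fromℕ : ∀ n → inc (fromℕ n) ≡ zero
inc-fromℕ n = toℕ-injective (begin
  toℕ (inc (fromℕ n))         ≡⟨ toℕ-fromℕ< _ ⟩
  suc (toℕ (fromℕ n)) % suc n ≡⟨ cong (λ k → suc k % suc n) (toℕ-fromℕ n) ⟩
  suc n % suc n               ≡⟨ n%n≡0 (suc n) ⟩
  0                           ∎)

inc-inject₁ : ∀ {n} (i : Fin n) → inc (inject₁ i) ≡ suc i
inc-inject₁ {n} i = toℕ-injective (begin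
  toℕ (inc (inject₁ i))         ≡⟨ toℕ-fromℕ< _ ⟩
  suc (toℕ (inject₁ i)) % suc n ≡⟨ cong (λ k → suc k % suc n) (toℕ-inject₁ i) ⟩
  suc (toℕ i) % suc n           ≡⟨ m<n⇒m%n≡m (ℕ.s<s (toℕ<n i)) ⟩
  suc (toℕ i)                   ∎)

inc-dec : ∀ {n} (i : Fin (suc n)) → inc (dec i) ≡ i
inc-dec {n} zero = inc-fromℕ n
inc-dec (suc i) = inc-inject₁ i

dec-inc : ∀ {n} (i : Fin (suc n)) → dec (inc i) ≡ i
dec-inc i with view i
... | ‵fromℕ     = cong dec (inc-fromℕ _)
... | ‵inject₁ j = cong dec (inc-inject₁ j)

inc↔ : ∀ {n} → Fin (suc n) ↔ Fin (suc n)
inc↔ = mk↔ₛ′ inc dec inc-dec dec-inc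

sgn-dec : ∀ n → sgn (dec {n}) ≡ parity n
sgn-dec n = begin
  ∑[ j < n ] (1ℙ + [ fromℕ n < inject₁ j ])
    + ∑∑ {n} (λ i j → [ i < j ] * ([ i < j ] + [ inject₁ i < inject₁ j ]))
    ≡⟨ cong₂ _+_ (sum-cong-≗ (λ j → cong (1ℙ +_) ([fromℕ<inject₁]≡0ℙ {n} j)))
                 (∑∑-cong {n} (λ i j → cong (λ b → [ i < j ] * ([ i < j ] + b)) ([<]-inject₁ i j))) ⟩
  ∑[ j < n ] 1ℙ + sgn {n} id
    ≡⟨ cong₂ _+_ (∑-1ℙ≡parity n) (sgn-id {n}) ⟩
  parity n + 0ℙ
    ≡⟨ +-identityʳ (parity n) ⟩
  parity n ∎

module _ {A : Set} (g : A → A) where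

  iter-+ : ∀ a b x → iter g (a ℕ.+ b) x ≡ iter g a (iter g b x)
  iter-+ zero    b x = refl
  iter-+ (suc a) b x = cong g (iter-+ a b x)

  iter-* : ∀ {d x} → iter g d x ≡ x → ∀ q → iter g (q ℕ.* d) x ≡ x
  iter-*             ret zero    = refl
  iter-* {d} {x} ret (suc q) = begin
    iter g (d ℕ.+ q ℕ.* d) x     ≡⟨ iter-+ d (q ℕ.* d) x ⟩
    iter g d (iter g (q ℕ.* d) x) ≡⟨ cong (iter g d) (iter-* ret q) ⟩
    iter g d x                   ≡⟨ ret ⟩
    x                            ∎

  iter-% : ∀ {d x} .{{_ : NonZero d}} → iter g d x ≡ x → ∀ k → iter g (k % d) x ≡ iter g k x
  iter-% {d} {x} ret k = sym (begin
    iter g k x                               ≡⟨ cong (λ t → iter g t x) (m≡m%n+[m/n]*n k d) ⟩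
    iter g (k % d ℕ.+ (k / d) ℕ.* d) x        ≡⟨ iter-+ (k % d) _ x ⟩
    iter g (k % d) (iter g ((k / d) ℕ.* d) x) ≡⟨ cong (iter g (k % d)) (iter-* ret (k / d)) ⟩
    iter g (k % d) x                         ∎)

  iter-injective : Injective _≡_ _≡_ g → ∀ k {x y} → iter g k x ≡ iter g k y → x ≡ y
  iter-injective g-inj zero    eq = eq
  iter-injective g-inj (suc k) eq = iter-injective g-inj k (g-inj eq)

SingleOrbit : ∀ {A : Set} → (A → A) → Set
SingleOrbit g = ∀ v w → ∃ λ k → iter g k v ≡ w

module Orbit {n} (G : Fin (suc n) → Fin (suc n)) (G-inj : Injective _≡_ _≡_ G)
             (reach : ∀ w → ∃ λ k → iter G k zero ≡ w) where

  orbit : ℕ → Fin (suc n)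
  orbit k = iter G k zero

  visit-time : ∀ d .{{_ : NonZero d}} → Fin (suc n) → Fin d
  visit-time d w = proj₁ (reach w) mod d

  orbit-visit-time : ∀ d .{{_ : NonZero d}} → orbit d ≡ zero →
                     ∀ w → orbit (toℕ (visit-time d w)) ≡ w
  orbit-visit-time d ret w = begin
    orbit (toℕ (visit-time d w))        ≡⟨ cong orbit (toℕ-fromℕ< (m%n<n (proj₁ (reach w)) d)) ⟩
    orbit (proj₁ (reach w) % d)         ≡⟨ iter-% G ret (proj₁ (reach w)) ⟩
    orbit (proj₁ (reach w))             ≡⟨ proj₂ (reach w) ⟩
    w                                   ∎

  -- Once the orbit returns at time d, every vertex is visited before time d.
  period-≥ : ∀ {d} → 0 < d → orbit d ≡ zero → suc n ≤ d
  period-≥ {suc d} _ ret = injective⇒≤ {f = visit-time (suc d)} λ {w} {w′} eq →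
    trans (sym (orbit-visit-time (suc d) ret w))
          (trans (cong (orbit ∘ toℕ) eq) (orbit-visit-time (suc d) ret w′))

  orbit-collision : ∀ {i j} → i ≤ j → orbit i ≡ orbit j → orbit (j ∸ i) ≡ zero
  orbit-collision {i} {j} i≤j eq = sym (iter-injective G G-inj i (begin
    orbit i                  ≡⟨ eq ⟩
    orbit j                  ≡⟨ cong orbit (m+[n∸m]≡n i≤j) ⟨
    orbit (i ℕ.+ (j ∸ i))    ≡⟨ iter-+ G i (j ∸ i) zero ⟩
    iter G i (orbit (j ∸ i)) ∎))

  orbit-period : orbit (suc n) ≡ zero
  orbit-period =
    let i , j , i<j , eq = pigeonhole (n<1+n (suc n)) (orbit ∘ toℕ)
        ret = orbit-collision (<⇒≤ i<j) eq
        j∸i≡1+n = ≤-antisym (≤-trans (m∸n≤m (toℕ j) (toℕ i)) (s≤s⁻¹ (toℕ<n j)))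
                            (period-≥ (m<n⇒0<n∸m i<j) ret)
    in subst (λ d → orbit d ≡ zero) j∸i≡1+n ret

  no-early-collision : ∀ {i j : Fin (suc n)} → i Fin.< j → orbit (toℕ i) ≢ orbit (toℕ j)
  no-early-collision {i} {j} i<j eq =
    <⇒≱ (toℕ<n j) (≤-trans (period-≥ (m<n⇒0<n∸m i<j) (orbit-collision (<⇒≤ i<j) eq))
                           (m∸n≤m (toℕ j) (toℕ i)))

  orbit-injective : Injective _≡_ _≡_ (orbit ∘ toℕ)
  orbit-injective {i} {j} eq with <-cmp i j
  ... | tri< i<j _ _ = contradiction eq (no-early-collision i<j)
  ... | tri≈ _ i≡j _ = i≡j
  ... | tri> _ _ j<i = contradiction (sym eq) (no-early-collision j<i)

  orbit↔ : Fin (suc n) ↔ Fin (suc n)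
  orbit↔ = mk↔ₛ′ (orbit ∘ toℕ) (visit-time (suc n)) (orbit-visit-time (suc n) orbit-period)
                 (λ i → orbit-injective {visit-time (suc n) (orbit (toℕ i))} {i}
                                        (orbit-visit-time (suc n) orbit-period (orbit (toℕ i))))

  G-shifts-orbit : ∀ (i : Fin (suc n)) → G (orbit (toℕ i)) ≡ orbit (toℕ (inc i))
  G-shifts-orbit i with view i
  ... | ‵fromℕ = begin
    G (orbit (toℕ (fromℕ n))) ≡⟨ cong (G ∘ orbit) (toℕ-fromℕ n) ⟩
    orbit (suc n)             ≡⟨ orbit-period ⟩
    zero                      ≡⟨ cong (orbit ∘ toℕ) (inc-fromℕ n) ⟨
    orbit (toℕ (inc (fromℕ n))) ∎
  ... | ‵inject₁ j =
    trans (cong (G ∘ orbit) (toℕ-inject₁ j)) (cong (orbit ∘ toℕ) (sym (inc-inject₁ j)))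

sgn-cycle : ∀ {n} {G : Fin n → Fin n} → Injective _≡_ _≡_ G → SingleOrbit G →
            sgn G ≡ parity (pred n)
sgn-cycle {zero} _ _ = refl
sgn-cycle {suc n} {G} G-inj orbits = begin
  sgn G           ≡⟨ sgn-conjugate G-inj orbit↔ (inc↔ {n}) G-shifts-orbit ⟩
  sgn {suc n} inc ≡⟨ sgn-inverse (inc↔ {n}) ⟨
  sgn (dec {n})   ≡⟨ sgn-dec n ⟩
  parity n        ∎
  where open Orbit {n} G G-inj (orbits zero)

module Enumerated {A : Set} {n : ℕ} (enum : A ↔ Fin n) where

  conj : (A → A) → Fin n → Fin n
  conj g = to enum ∘ g ∘ from enum

  conj↔ : A ↔ A → Fin n ↔ Fin n
  conj↔ π = ↔-trans (↔-sym enum) (↔-trans π enum)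

  conj-injective : ∀ {g} → Injective _≡_ _≡_ g → Injective _≡_ _≡_ (conj g)
  conj-injective g-inj = to-injective (↔-sym enum) ∘ g-inj ∘ to-injective enum

  sign : (A → A) → Parity
  sign g = sgn (conj g)

  sign-cong : ∀ {g h} → g ≗ h → sign g ≡ sign h
  sign-cong g≗h = sgn-cong (λ i → cong (to enum) (g≗h (from enum i)))

  sign-∘ : ∀ {g} → Injective _≡_ _≡_ g → (π : A ↔ A) →
           sign (g ∘ to π) ≡ sign g + sign (to π)
  sign-∘ {g} g-inj π = trans (sgn-cong (λ i → cong (to enum ∘ g) (sym (strictlyInverseʳ enum _))))
                             (sgn-∘ (conj-injective g-inj) (conj↔ π))

  sign-inverse : (π : A ↔ A) → sign (from π) ≡ sign (to π)
  sign-inverse π = sgn-inverse (conj↔ π)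

  sign-square : (U : A → A) (π : A ↔ A) → U ∘ U ≗ to π → sign (to π) ≡ 0ℙ
  sign-square U π U²≗π = begin
    sign (to π)   ≡⟨ sign-cong U²≗π ⟨
    sign (U ∘ U)  ≡⟨ sign-∘ (to-injective U↔) U↔ ⟩
    sign U + sign U ≡⟨ p+p≡0ℙ (sign U) ⟩
    0ℙ            ∎
    where
    U⁻¹ : A → A
    U⁻¹ = U ∘ from π
    from-π-U-U : ∀ x → from π (U (U x)) ≡ x
    from-π-U-U x = trans (cong (from π) (U²≗π x)) (strictlyInverseʳ π x)
    U-U⁻¹ : ∀ x → U (U⁻¹ x) ≡ x
    U-U⁻¹ x = trans (U²≗π (from π x)) (strictlyInverseˡ π x)
    -- U⁻¹ is a right inverse and from π ∘ U a left inverse of U, so they agree.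
    U⁻¹-U : ∀ x → U⁻¹ (U x) ≡ x
    U⁻¹-U x = begin
      U⁻¹ (U x)                   ≡⟨ from-π-U-U (U⁻¹ (U x)) ⟨
      from π (U (U (U⁻¹ (U x))))  ≡⟨ cong (from π ∘ U) (U-U⁻¹ (U x)) ⟩
      from π (U (U x))            ≡⟨ from-π-U-U x ⟩
      x                           ∎
    U↔ : A ↔ A
    U↔ = mk↔ₛ′ U U⁻¹ U-U⁻¹ U⁻¹-U

  sign-cycle : ∀ {g} → Injective _≡_ _≡_ g → SingleOrbit g → sign g ≡ parity (pred n)
  sign-cycle {g} g-inj orbits = sgn-cycle (conj-injective g-inj) conj-orbits
    where
    iter-conj : ∀ k i → iter (conj g) k i ≡ to enum (iter g k (from enum i))
    iter-conj zero    i = sym (strictlyInverseˡ enum i)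
    iter-conj (suc k) i =
      trans (cong (conj g) (iter-conj k i)) (cong (to enum ∘ g) (strictlyInverseʳ enum _))
    conj-orbits : SingleOrbit (conj g)
    conj-orbits i j = let k , eq = orbits (from enum i) (from enum j) in
      k , trans (iter-conj k i) (trans (cong (to enum) eq) (strictlyInverseˡ enum j))

-- Kempe swaps

V↔Fin : ∀ m → V m ↔ Fin (m ℕ.* (m ℕ.* m))
V↔Fin m = ↔-sym (↔-trans *↔× (↔-refl ×-↔ *↔×))

module SignV (m : ℕ) = Enumerated (V↔Fin m)

totalSign : ∀ {m} → Maps m → Parity
totalSign {m} f = ∑[ c < 3 ] SignV.sign m (f c)

∑₃-shift-pair : ∀ (h h′ : Fin 3 → Parity) {r s} x → r ≢ s →
                h′ r ≡ h r + x → h′ s ≡ h s + x → (∀ t → t ≢ r → t ≢ s → h′ t ≡ h t) →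
                ∑[ c < 3 ] h′ c ≡ ∑[ c < 3 ] h c
∑₃-shift-pair h h′ {r} {s} x = shift r s
  where
  twice₀₁ : ∀ a b c x → (a + x) + ((b + x) + (c + 0ℙ)) ≡ a + (b + (c + 0ℙ))
  twice₀₁ = solve-∀ ℙ-ring
  twice₀₂ : ∀ a b c x → (a + x) + (b + ((c + x) + 0ℙ)) ≡ a + (b + (c + 0ℙ))
  twice₀₂ = solve-∀ ℙ-ring
  twice₁₂ : ∀ a b c x → a + ((b + x) + ((c + x) + 0ℙ)) ≡ a + (b + (c + 0ℙ))
  twice₁₂ = solve-∀ ℙ-ring
  shift : ∀ r s → r ≢ s →
          h′ r ≡ h r + x → h′ s ≡ h s + x → (∀ t → t ≢ r → t ≢ s → h′ t ≡ h t) →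
          ∑[ c < 3 ] h′ c ≡ ∑[ c < 3 ] h c
  shift 0F 0F r≢s _ _ _ = contradiction refl r≢s
  shift 1F 1F r≢s _ _ _ = contradiction refl r≢s
  shift 2F 2F r≢s _ _ _ = contradiction refl r≢s
  shift 0F 1F _ hr hs ht rewrite hr | hs | ht 2F (λ ()) (λ ()) = twice₀₁ (h 0F) (h 1F) (h 2F) x
  shift 1F 0F _ hr hs ht rewrite hr | hs | ht 2F (λ ()) (λ ()) = twice₀₁ (h 0F) (h 1F) (h 2F) x
  shift 0F 2F _ hr hs ht rewrite hr | hs | ht 1F (λ ()) (λ ()) = twice₀₂ (h 0F) (h 1F) (h 2F) x
  shift 2F 0F _ hr hs ht rewrite hr | hs | ht 1F (λ ()) (λ ()) = twice₀₂ (h 0F) (h 1F) (h 2F) x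
  shift 1F 2F _ hr hs ht rewrite hr | hs | ht 0F (λ ()) (λ ()) = twice₁₂ (h 0F) (h 1F) (h 2F) x
  shift 2F 1F _ hr hs ht rewrite hr | hs | ht 0F (λ ()) (λ ()) = twice₁₂ (h 0F) (h 1F) (h 2F) x

module Kempe {m} .{{_ : NonZero m}} {f : Maps m} (f-bij : ∀ c → Bijective _≡_ _≡_ (f c)) where

  f↔ : Fin 3 → V m ↔ V m
  f↔ c = ⤖⇒↔ (mk⤖ (f-bij c))

  τ : Fin 3 → Fin 3 → V m → V m
  τ r s = from (f↔ s) ∘ f r

  τ-on : (V m → Bool) → Fin 3 → Fin 3 → V m → V m
  τ-on X r s v = if X v then τ r s v else v

  τ-τ : ∀ r s v → τ s r (τ r s v) ≡ v
  τ-τ r s v =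
    trans (cong (from (f↔ r)) (strictlyInverseˡ (f↔ s) (f r v))) (strictlyInverseʳ (f↔ r) v)

  τ-on-τ-on : ∀ X r s → (∀ v → X (τ r s v) ≡ X v) → ∀ v → τ-on X s r (τ-on X r s v) ≡ v
  τ-on-τ-on X r s X-τ v with X v in Xv
  ... | true rewrite X-τ v | Xv = τ-τ r s v
  ... | false rewrite Xv = refl

  module _ {r s : Fin 3} (X : V m → Bool) where

    ρ↔ : IsUnionOfCycles f r s X → V m ↔ V m
    ρ↔ closed = mk↔ₛ′ (τ-on X s r) (τ-on X r s) (τ-on-τ-on X r s X-τrs) (τ-on-τ-on X s r X-τsr)
      where
      X-τrs : ∀ v → X (τ r s v) ≡ X v
      X-τrs v = sym (⇔→≡ (closed v (τ r s v) (strictlyInverseˡ (f↔ s) (f r v))))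
      X-τsr : ∀ v → X (τ s r v) ≡ X v
      X-τsr v = ⇔→≡ (closed (τ s r v) v (sym (strictlyInverseˡ (f↔ r) (f s v))))

    swap-at-r : ∀ v → swap f r s X r v ≡ f r (τ-on X s r v)
    swap-at-r v with X v | r ≟ r | r ≟ s
    ... | false | _     | _ = refl
    ... | true  | yes _ | _ = sym (strictlyInverseˡ (f↔ r) (f s v))
    ... | true  | no r≢r | _ = contradiction refl r≢r

    swap-at-s : r ≢ s → ∀ v → swap f r s X s v ≡ f s (τ-on X r s v)
    swap-at-s r≢s v with X v | s ≟ r | s ≟ s
    ... | false | _       | _      = refl
    ... | true  | yes s≡r | _      = contradiction (sym s≡r) r≢s
    ... | true  | no _    | yes _  = sym (strictlyInverseˡ (f↔ s) (f r v))
    ... | true  | no _    | no s≢s = contradiction refl s≢s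

    swap-elsewhere : ∀ t → t ≢ r → t ≢ s → ∀ v → swap f r s X t v ≡ f t v
    swap-elsewhere t t≢r t≢s v with X v | t ≟ r | t ≟ s
    ... | false | _       | _       = refl
    ... | true  | yes t≡r | _       = contradiction t≡r t≢r
    ... | true  | no _    | yes t≡s = contradiction t≡s t≢s
    ... | true  | no _    | no _    = refl

totalSign-step : ∀ {m} .{{_ : NonZero m}} {f g : Maps m} → KempeStep f g → totalSign g ≡ totalSign f
totalSign-step {m} {f = f} {g} ((f-bij , _) , r , s , r≢s , X , closed , g≗swap) =
  ∑₃-shift-pair (λ c → sign (f c)) (λ c → sign (g c)) (sign (to ρ)) r≢s sign-g-r sign-g-s sign-g-t
  where
  open SignV m
  open Kempe f-bij
  ρ : V m ↔ V m
  ρ = ρ↔ X closed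
  sign-g-r : sign (g r) ≡ sign (f r) + sign (to ρ)
  sign-g-r = trans (sign-cong (λ v → trans (g≗swap r v) (swap-at-r X v)))
                   (sign-∘ (proj₁ (f-bij r)) ρ)
  sign-g-s : sign (g s) ≡ sign (f s) + sign (to ρ)
  sign-g-s = begin
    sign (g s)                  ≡⟨ sign-cong (λ v → trans (g≗swap s v) (swap-at-s X r≢s v)) ⟩
    sign (f s ∘ from ρ)         ≡⟨ sign-∘ (proj₁ (f-bij s)) (↔-sym ρ) ⟩
    sign (f s) + sign (from ρ)  ≡⟨ cong (sign (f s) +_) (sign-inverse ρ) ⟩
    sign (f s) + sign (to ρ)    ∎
  sign-g-t : ∀ t → t ≢ r → t ≢ s → sign (g t) ≡ sign (f t)
  sign-g-t t t≢r t≢s = sign-cong (λ v → trans (g≗swap t v) (swap-elsewhere X t t≢r t≢s v))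

totalSign-reachable : ∀ {m} .{{_ : NonZero m}} {f g : Maps m} →
                      KempeReachable f g → totalSign g ≡ totalSign f
totalSign-reachable ε = refl
totalSign-reachable (step ◅ steps) = trans (totalSign-reachable steps) (totalSign-step step)

-- Translations of V for even m

module _ {n : ℕ} where

  parity-inc : parity (suc n) ≡ 0ℙ →
               ∀ (i : Fin (suc n)) → parity (toℕ (inc i)) ≡ parity (toℕ i) ⁻¹
  parity-inc even i with view i
  ... | ‵fromℕ = begin
    parity (toℕ (inc (fromℕ n))) ≡⟨ cong (parity ∘ toℕ) (inc-fromℕ n) ⟩
    0ℙ                           ≡⟨ even ⟨
    parity (suc n)               ≡⟨ parity-suc n ⟩
    parity n ⁻¹                  ≡⟨ cong (λ k → parity k ⁻¹) (toℕ-fromℕ n) ⟨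
    parity (toℕ (fromℕ n)) ⁻¹    ∎
  ... | ‵inject₁ j = begin
    parity (toℕ (inc (inject₁ j))) ≡⟨ cong (parity ∘ toℕ) (inc-inject₁ j) ⟩
    parity (suc (toℕ j))           ≡⟨ parity-suc (toℕ j) ⟩
    parity (toℕ j) ⁻¹              ≡⟨ cong (λ k → parity k ⁻¹) (toℕ-inject₁ j) ⟨
    parity (toℕ (inject₁ j)) ⁻¹    ∎

  parity-dec : parity (suc n) ≡ 0ℙ →
               ∀ (i : Fin (suc n)) → parity (toℕ (dec i)) ≡ parity (toℕ i) ⁻¹
  parity-dec even i = sym (⁻¹-selfInverse (sym (begin
    parity (toℕ i)               ≡⟨ cong (parity ∘ toℕ) (inc-dec i) ⟨
    parity (toℕ (inc (dec i)))   ≡⟨ parity-inc even (dec i) ⟩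
    parity (toℕ (dec i)) ⁻¹      ∎)))

  -- A square root of (x , y) ↦ (inc x , y): for even m each step flips the parity of y, so the two
  -- branches alternate.
  halfShiftBy : Parity → Fin (suc n) → Fin (suc n) → Fin (suc n) × Fin (suc n)
  halfShiftBy 0ℙ x y = inc x , dec y
  halfShiftBy 1ℙ x y = x , inc y

  halfShift : Fin (suc n) × Fin (suc n) → Fin (suc n) × Fin (suc n)
  halfShift (x , y) = halfShiftBy (parity (toℕ y)) x y

  halfShift-square : parity (suc n) ≡ 0ℙ → ∀ x y → halfShift (halfShift (x , y)) ≡ (inc x , y)
  halfShift-square even x y with parity (toℕ y) in py
  ... | 0ℙ = trans (cong (λ p → halfShiftBy p (inc x) (dec y)) (trans (parity-dec even y) (cong _⁻¹ py)))
                   (cong (inc x ,_) (inc-dec y))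
  ... | 1ℙ = trans (cong (λ p → halfShiftBy p x (inc y)) (trans (parity-inc even y) (cong _⁻¹ py)))
                   (cong (inc x ,_) (dec-inc y))

  halfShiftAt : Fin 3 → V (suc n) → V (suc n)
  halfShiftAt 0F (a , b , c) = let a′ , b′ = halfShift (a , b) in a′ , b′ , c
  halfShiftAt 1F (a , b , c) = let b′ , c′ = halfShift (b , c) in a , b′ , c′
  halfShiftAt 2F (a , b , c) = let c′ , a′ = halfShift (c , a) in a′ , b , c′

  halfShiftAt-square : parity (suc n) ≡ 0ℙ → ∀ i v → halfShiftAt i (halfShiftAt i v) ≡ v +e i
  halfShiftAt-square ev 0F (a , b , c) = cong (λ (a′ , b′) → a′ , b′ , c) (halfShift-square ev a b)
  halfShiftAt-square ev 1F (a , b , c) = cong (λ (b′ , c′) → a , b′ , c′) (halfShift-square ev b c)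
  halfShiftAt-square ev 2F (a , b , c) = cong (λ (c′ , a′) → a′ , b , c′) (halfShift-square ev c a)

  _-e_ : V (suc n) → Fin 3 → V (suc n)
  (a , b , c) -e 0F = dec a , b , c
  (a , b , c) -e 1F = a , dec b , c
  (a , b , c) -e 2F = a , b , dec c

  +e-−e : ∀ i v → (v -e i) +e i ≡ v
  +e-−e 0F (a , b , c) = cong (_, b , c) (inc-dec a)
  +e-−e 1F (a , b , c) = cong (λ b′ → a , b′ , c) (inc-dec b)
  +e-−e 2F (a , b , c) = cong (λ c′ → a , b , c′) (inc-dec c)

  −e-+e : ∀ i v → (v +e i) -e i ≡ v
  −e-+e 0F (a , b , c) = cong (_, b , c) (dec-inc a)
  −e-+e 1F (a , b , c) = cong (λ b′ → a , b′ , c) (dec-inc b)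
  −e-+e 2F (a , b , c) = cong (λ c′ → a , b , c′) (dec-inc c)

  shift↔ : Fin 3 → V (suc n) ↔ V (suc n)
  shift↔ i = mk↔ₛ′ (_+e i) (_-e i) (+e-−e i) (−e-+e i)

  totalSign-canonical : parity (suc n) ≡ 0ℙ → totalSign {suc n} canonical ≡ 0ℙ
  totalSign-canonical even = trans (sum-cong-≗ sign-shift) (sum-replicate-zero 3)
    where
    open SignV (suc n)
    sign-shift : ∀ i → sign (_+e i) ≡ 0ℙ
    sign-shift i = sign-square (halfShiftAt i) (shift↔ i) (halfShiftAt-square even i)

  totalSign-hamiltonian : parity (suc n) ≡ 0ℙ → ∀ {f : Maps (suc n)} →
                          (∀ c → Injective _≡_ _≡_ (f c)) → (∀ c → IsSingleCycle (f c)) →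
                          totalSign f ≡ 1ℙ
  totalSign-hamiltonian even {f} f-inj hamiltonian = sum-cong-≗ sign-odd
    where
    open SignV (suc n)
    m³ : ℕ
    m³ = suc n ℕ.* (suc n ℕ.* suc n)
    m³-even : parity m³ ≡ 0ℙ
    m³-even = trans (*-homo-* (suc n) (suc n ℕ.* suc n)) (cong (_* parity (suc n ℕ.* suc n)) even)
    sign-odd : ∀ c → sign (f c) ≡ 1ℙ
    sign-odd c = begin
      sign (f c)         ≡⟨ sign-cycle (f-inj c) (hamiltonian c) ⟩
      parity (pred m³)   ≡⟨ suc-homo-⁻¹ (pred m³) ⟨
      parity m³ ⁻¹       ≡⟨ cong _⁻¹ m³-even ⟩
      1ℙ                 ∎

corollary2p6 : (m : ℕ) .{{_ : NonZero m}} → 4 ≤ m → 2 ∣ m →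
    (f : Maps m) →
    ¬ (KempeReachable canonical f × IsColoring f × (∀ c → IsSingleCycle (f c)))
corollary2p6 (suc n) _ 2∣m f (reachable , (f-bij , _) , hamiltonian) = contradiction 1ℙ≡0ℙ λ ()
  where
  even : parity (suc n) ≡ 0ℙ
  even = parity-even 2∣m
  1ℙ≡0ℙ : 1ℙ ≡ 0ℙ
  1ℙ≡0ℙ = begin
    1ℙ                          ≡⟨ totalSign-hamiltonian {n} even (proj₁ ∘ f-bij) hamiltonian ⟨
    totalSign f                 ≡⟨ totalSign-reachable reachable ⟩
    totalSign {suc n} canonical ≡⟨ totalSign-canonical {n} even ⟩
    0ℙ                          ∎
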